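{- Let $Z_1,Z_2$ be finite abelian groups with coprime orders, and let $\ell\in\mathbb{N}$. Then every nilspace morphism $\mathcal{D}_1(Z_1)\to\mathcal{D}_\ell(Z_2)$ is constant.
   Context: For an abelian group $Z$ and $j\in\mathbb{N}$, $\mathcal{D}_j(Z)$ is the nilspace on $Z$ whose $n$-cubes are the maps $c:\{0,1\}^n\to Z$ such that $\sum_{w\in\{0,1\}^{j+1}}(-1)^{|w|}c(\psi(w))=0$ for every injective cube morphism $\psi:\{0,1\}^{j+1}\to\{0,1\}^n$ (cube morphisms being restrictions of affine maps $\mathbb{Z}^{j+1}\to\mathbb{Z}^n$; $|w|=\sum w_i$). A morphism $\phi:\mathcal{D}_1(Z_1)\to\mathcal{D}_\ell(Z_2)$ is a map with $\phi\circ c$ an $n$-cube of $\mathcal{D}_\ell(Z_2)$ for every $n$-cube $c$ of $\mathcal{D}_1(Z_1)$ and every $n$. -}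

module Defs where

open import Level using (Level; _⊔_)
open import Data.Nat using (ℕ; zero; suc)
open import Data.Nat.Coprimality using (Coprime)
open import Data.Bool using (Bool; true; false)
open import Data.Fin using (Fin)
import Data.Fin as Fin
open import Data.Vec using (Vec; []; _∷_; lookup)
open import Data.Integer using (ℤ; _+_; _*_; +_)
open import Data.Product using (Σ; _×_; ∃)
open import Relation.Binary.PropositionalEquality using (_≡_)
import Relation.Binary.PropositionalEquality as P
open import Function.Definitions using (Injective; Congruent)
open import Function.Bundles using (Inverse)
open import Algebra.Bundles using (AbelianGroup)

Vertex : ℕ → Set
Vertex n = Vec Bool n

⟦_⟧ : Bool → ℤ
⟦ false ⟧ = + 0
⟦ true ⟧ = + 1

∑ : (m : ℕ) → (Fin m → ℤ) → ℤ
∑ zero f = + 0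
∑ (suc m) f = f Fin.zero + ∑ m (λ k → f (Fin.suc k))

IsCubeMorphism : (m n : ℕ) → (Vertex m → Vertex n) → Set
IsCubeMorphism m n ψ =
  Σ (Fin n → ℤ) λ a → Σ (Fin n → Fin m → ℤ) λ M →
    ∀ (w : Vertex m) (i : Fin n) →
      ⟦ lookup (ψ w) i ⟧ ≡ a i + ∑ m (λ k → M i k * ⟦ lookup w k ⟧)

module _ {c ℓ : Level} (Z : AbelianGroup c ℓ) where
  open AbelianGroup Z

  -- ∑_{w ∈ {0,1}^m} (-1)^{|w|} f(w)
  altSum : (m : ℕ) → (Vertex m → Carrier) → Carrier
  altSum zero f = f []
  altSum (suc m) f = altSum m (λ w → f (false ∷ w)) ∙ (altSum m (λ w → f (true ∷ w))) ⁻¹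

  IsCube : (j n : ℕ) → (Vertex n → Carrier) → Set ℓ
  IsCube j n cube =
    ∀ (ψ : Vertex (suc j) → Vertex n) →
      IsCubeMorphism (suc j) n ψ → Injective _≡_ _≡_ ψ →
      altSum (suc j) (λ w → cube (ψ w)) ≈ ε

HasOrder : {c ℓ : Level} → AbelianGroup c ℓ → ℕ → Set (c ⊔ ℓ)
HasOrder Z n = Inverse (AbelianGroup.setoid Z) (P.setoid (Fin n))

IsNilspaceMorphism : {c₁ ℓ₁ c₂ ℓ₂ : Level} →
  (Z₁ : AbelianGroup c₁ ℓ₁) (j : ℕ) (Z₂ : AbelianGroup c₂ ℓ₂) (k : ℕ) →
  (AbelianGroup.Carrier Z₁ → AbelianGroup.Carrier Z₂) → Set (c₁ ⊔ ℓ₁ ⊔ ℓ₂)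
IsNilspaceMorphism Z₁ j Z₂ k φ =
  Congruent (AbelianGroup._≈_ Z₁) (AbelianGroup._≈_ Z₂) φ ×
  (∀ (n : ℕ) (cube : Vertex n → AbelianGroup.Carrier Z₁) →
     IsCube Z₁ j n cube → IsCube Z₂ k n (λ v → φ (cube v)))

-- A morphism φ : D₁(Z₁) → D_ℓ(Z₂) sends each parallelepiped x + {0,1}^(ℓ+1)·h, a cube of
-- D₁(Z₁), to a cube of D_ℓ(Z₂); so all (ℓ+1)-fold differences of φ vanish, i.e. φ is a
-- polynomial of degree ≤ ℓ. The degree then drops step by step: if the differences of Δ_h g
-- vanish, Δ_h g is translation invariant, so telescoping g along x, x + h, …, x + n₁h gives
-- n₁ · Δ_h g = 0 by Lagrange in Z₁, while n₂ · Δ_h g = 0 by Lagrange in Z₂, and a Bézout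
-- identity for the coprime n₁, n₂ gives Δ_h g = 0. Polynomials of degree 0 are constant.
module Submission where

open import Defs
open import Level using (Level; _⊔_)
open import Data.Nat as ℕ using (ℕ; zero; suc)
open import Data.Fin as Fin using (Fin)
open import Data.Bool using (Bool; true; false)
open import Data.Vec using (Vec; []; _∷_; lookup)
open import Data.Product using (_,_)
open import Data.Integer as ℤ using (ℤ; +_)
import Data.Integer.Properties as ℤ
open import Data.Integer.Tactic.RingSolver using (solve-∀)
open import Data.Nat.Coprimality using (Coprime; coprime-Bézout)
open import Data.Nat.GCD using (module Bézout)
open import Data.Fin.Permutation using (Permutation; _⟨$⟩ʳ_)
open import Function.Base using (_∘_; id)
open import Function.Bundles using (Inverse)
open import Function.Definitions using (Congruent)
import Function.Construct.Composition as Compose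
import Function.Construct.Symmetry as Symmetry
open import Relation.Binary.PropositionalEquality as ≡ using (_≡_)
open import Algebra.Bundles using (AbelianGroup)

corner : Bool → Bool → Vertex 2
corner u v = u ∷ v ∷ []

bit : Bool → ℕ
bit false = 0
bit true  = 1

⟦⟧≡+bit : ∀ b → ⟦ b ⟧ ≡ + bit b
⟦⟧≡+bit false = ≡.refl
⟦⟧≡+bit true  = ≡.refl

affine-exchange : ∀ a m₀ m₁ u₀ u₁ v₀ v₁ →
  (a ℤ.+ (m₀ ℤ.* u₀ ℤ.+ (m₁ ℤ.* v₀ ℤ.+ + 0))) ℤ.+ (a ℤ.+ (m₀ ℤ.* u₁ ℤ.+ (m₁ ℤ.* v₁ ℤ.+ + 0)))
    ≡ (a ℤ.+ (m₀ ℤ.* u₀ ℤ.+ (m₁ ℤ.* v₁ ℤ.+ + 0))) ℤ.+ (a ℤ.+ (m₀ ℤ.* u₁ ℤ.+ (m₁ ℤ.* v₀ ℤ.+ + 0)))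
affine-exchange = solve-∀

cubeMorphism-parallelogram : ∀ {n} (ψ : Vertex 2 → Vertex n) → IsCubeMorphism 2 n ψ → ∀ i →
  bit (lookup (ψ (corner false false)) i) ℕ.+ bit (lookup (ψ (corner true true)) i)
    ≡ bit (lookup (ψ (corner false true)) i) ℕ.+ bit (lookup (ψ (corner true false)) i)
cubeMorphism-parallelogram ψ (a , M , ψ≡affine) i = ℤ.+-injective (begin
  + (bit p ℕ.+ bit s)       ≡⟨ ℤ.pos-+ (bit p) (bit s) ⟩
  + bit p ℤ.+ + bit s       ≡⟨ ≡.cong₂ ℤ._+_ (⟦⟧≡+bit p) (⟦⟧≡+bit s) ⟨
  ⟦ p ⟧ ℤ.+ ⟦ s ⟧           ≡⟨ ≡.cong₂ ℤ._+_ (ψ≡affine (corner false false) i) (ψ≡affine (corner true true) i) ⟩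
  _                         ≡⟨ affine-exchange (a i) (M i Fin.zero) (M i (Fin.suc Fin.zero)) _ _ _ _ ⟩
  _                         ≡⟨ ≡.cong₂ ℤ._+_ (ψ≡affine (corner false true) i) (ψ≡affine (corner true false) i) ⟨
  ⟦ q ⟧ ℤ.+ ⟦ r ⟧           ≡⟨ ≡.cong₂ ℤ._+_ (⟦⟧≡+bit q) (⟦⟧≡+bit r) ⟩
  + bit q ℤ.+ + bit r       ≡⟨ ℤ.pos-+ (bit q) (bit r) ⟨
  + (bit q ℕ.+ bit r)       ∎)
  where
  open ≡.≡-Reasoning
  p q r s : Bool
  p = lookup (ψ (corner false false)) i
  q = lookup (ψ (corner false true)) i
  r = lookup (ψ (corner true false)) i
  s = lookup (ψ (corner true true)) i

δ : ∀ {m} → Fin m → Fin m → ℤ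
δ Fin.zero    Fin.zero    = + 1
δ Fin.zero    (Fin.suc _) = + 0
δ (Fin.suc _) Fin.zero    = + 0
δ (Fin.suc i) (Fin.suc k) = δ i k

∑-*-zeroˡ : ∀ m (v : Fin m → ℤ) → ∑ m (λ k → + 0 ℤ.* v k) ≡ + 0
∑-*-zeroˡ zero    v = ≡.refl
∑-*-zeroˡ (suc m) v = ≡.cong₂ ℤ._+_ (ℤ.*-zeroˡ (v Fin.zero)) (∑-*-zeroˡ m (λ k → v (Fin.suc k)))

∑-δ : ∀ m (i : Fin m) (v : Fin m → ℤ) → ∑ m (λ k → δ i k ℤ.* v k) ≡ v i
∑-δ (suc m) Fin.zero v = begin
  + 1 ℤ.* v Fin.zero ℤ.+ ∑ m (λ k → + 0 ℤ.* v′ k)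
    ≡⟨ ≡.cong₂ ℤ._+_ (ℤ.*-identityˡ (v Fin.zero)) (∑-*-zeroˡ m v′) ⟩
  v Fin.zero ℤ.+ + 0                              ≡⟨ ℤ.+-identityʳ (v Fin.zero) ⟩
  v Fin.zero                                      ∎
  where
  open ≡.≡-Reasoning
  v′ : Fin m → ℤ
  v′ k = v (Fin.suc k)
∑-δ (suc m) (Fin.suc i) v = begin
  + 0 ℤ.* v Fin.zero ℤ.+ ∑ m (λ k → δ i k ℤ.* v′ k)
    ≡⟨ ≡.cong (ℤ._+ ∑ m (λ k → δ i k ℤ.* v′ k)) (ℤ.*-zeroˡ (v Fin.zero)) ⟩
  + 0 ℤ.+ ∑ m (λ k → δ i k ℤ.* v′ k)                 ≡⟨ ℤ.+-identityˡ _ ⟩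
  ∑ m (λ k → δ i k ℤ.* v′ k)                         ≡⟨ ∑-δ m i v′ ⟩
  v′ i                                               ∎
  where
  open ≡.≡-Reasoning
  v′ : Fin m → ℤ
  v′ k = v (Fin.suc k)

id-isCubeMorphism : ∀ n → IsCubeMorphism n n (λ w → w)
id-isCubeMorphism n = (λ _ → + 0) , δ , λ w i →
  ≡.sym (≡.trans (ℤ.+-identityˡ _) (∑-δ n i (λ k → ⟦ lookup w k ⟧)))

module AbelianGroupProperties {c ℓ : Level} (Z : AbelianGroup c ℓ) where
  open AbelianGroup Z
  open import Algebra.Properties.Group group
    using (//-rightDividesˡ; //-rightDividesʳ; //-cong₂; ∙-cancelˡ; ⁻¹-involutive)
  open import Algebra.Properties.AbelianGroup Z using (⁻¹-anti-homo‿-; ⁻¹-∙-comm)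
  open import Algebra.Properties.CommutativeSemigroup commutativeSemigroup using (interchange)
  open import Algebra.Definitions.RawMonoid rawMonoid public using (_×_)
  open import Algebra.Properties.Monoid.Mult monoid using (×-congʳ; ×-homo-1; ×-homo-+; ×-assocˡ)
  open import Algebra.Properties.CommutativeMonoid.Sum commutativeMonoid
    using (sum; sum-permute; sum-cong-≋; sum-replicate; sum-replicate-zero; ∑-distrib-+)
  open import Relation.Binary.Reasoning.Setoid setoid

  ×-zeroʳ : ∀ n → n × ε ≈ ε
  ×-zeroʳ n = trans (sym (sum-replicate n)) (sum-replicate-zero n)

  translation : Carrier → Inverse setoid setoid
  translation h = record
    { to        = _∙ h
    ; from      = _- h
    ; to-cong   = ∙-congʳ
    ; from-cong = λ x≈y → //-cong₂ x≈y refl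
    ; inverse   = (λ {x} y≈x-h → trans (∙-congʳ y≈x-h) (//-rightDividesˡ h x))
                , (λ {x} y≈x∙h → trans (//-cong₂ y≈x∙h refl) (//-rightDividesʳ h x))
    }

  HasOrder⇒×≈ε : ∀ {n} → HasOrder Z n → ∀ h → n × h ≈ ε
  HasOrder⇒×≈ε {n} Z≅Fin h = ∙-cancelˡ (sum from) _ _ (begin
    sum from ∙ n × h                ≈⟨ ∙-congˡ (sum-replicate n) ⟨
    sum from ∙ sum {n} (λ _ → h)    ≈⟨ ∑-distrib-+ {n} from (λ _ → h) ⟨
    sum (λ i → from i ∙ h)          ≈⟨ sum-cong-≋ {n} (λ i → sym (from∘to ≡.refl)) ⟩
    sum (λ i → from (π ⟨$⟩ʳ i))     ≈⟨ sum-permute from π ⟨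
    sum from                        ≈⟨ identityʳ _ ⟨
    sum from ∙ ε                    ∎)
    where
    open Inverse Z≅Fin using (from) renaming (inverseʳ to from∘to)
    π : Permutation n n
    π = Compose.inverse (Symmetry.inverse Z≅Fin) (Compose.inverse (translation h) Z≅Fin)

  bézout-×≈ε⇒≈ε : ∀ {a b x y e} → a × e ≈ ε → b × e ≈ ε → 1 ℕ.+ y ℕ.* a ≡ x ℕ.* b → e ≈ ε
  bézout-×≈ε⇒≈ε {a} {b} {x} {y} {e} a×e≈ε b×e≈ε 1+ya≡xb = begin
    e                      ≈⟨ identityʳ e ⟨
    e ∙ ε                  ≈⟨ ∙-congˡ (trans (×-congʳ y a×e≈ε) (×-zeroʳ y)) ⟨
    e ∙ y × (a × e)        ≈⟨ ∙-congˡ (×-assocˡ e y a) ⟩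
    (1 ℕ.+ y ℕ.* a) × e    ≡⟨ ≡.cong (_× e) 1+ya≡xb ⟩
    (x ℕ.* b) × e          ≈⟨ ×-assocˡ e x b ⟨
    x × (b × e)            ≈⟨ trans (×-congʳ x b×e≈ε) (×-zeroʳ x) ⟩
    ε                      ∎

  coprime-×≈ε⇒≈ε : ∀ {m n} → Coprime m n → ∀ {e} → m × e ≈ ε → n × e ≈ ε → e ≈ ε
  coprime-×≈ε⇒≈ε m⊥n m×e≈ε n×e≈ε with coprime-Bézout m⊥n
  ... | Bézout.+- x y 1+yn≡xm = bézout-×≈ε⇒≈ε {x = x} {y} n×e≈ε m×e≈ε 1+yn≡xm
  ... | Bézout.-+ x y 1+xm≡yn = bézout-×≈ε⇒≈ε {x = y} {x} m×e≈ε n×e≈ε 1+xm≡yn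

  altSum-cong : ∀ m {f g : Vertex m → Carrier} → (∀ w → f w ≈ g w) → altSum Z m f ≈ altSum Z m g
  altSum-cong zero    f≈g = f≈g []
  altSum-cong (suc m) f≈g =
    //-cong₂ (altSum-cong m (λ w → f≈g (false ∷ w))) (altSum-cong m (λ w → f≈g (true ∷ w)))

  altSum₂≈ε : (g : Vertex 2 → Carrier) →
    g (corner false false) ∙ g (corner true true) ≈ g (corner false true) ∙ g (corner true false) →
    altSum Z 2 g ≈ ε
  altSum₂≈ε g parallelogram = begin
    (g₀₀ - g₀₁) - (g₁₀ - g₁₁)        ≈⟨ //-cong₂ refl (⁻¹-anti-homo‿- g₁₁ g₁₀) ⟨
    (g₀₀ - g₀₁) - (g₁₁ - g₁₀) ⁻¹     ≈⟨ ∙-congˡ (⁻¹-involutive (g₁₁ - g₁₀)) ⟩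
    (g₀₀ - g₀₁) ∙ (g₁₁ - g₁₀)        ≈⟨ interchange g₀₀ (g₀₁ ⁻¹) g₁₁ (g₁₀ ⁻¹) ⟩
    (g₀₀ ∙ g₁₁) ∙ (g₀₁ ⁻¹ ∙ g₁₀ ⁻¹)  ≈⟨ ∙-cong parallelogram (⁻¹-∙-comm g₀₁ g₁₀) ⟩
    (g₀₁ ∙ g₁₀) - (g₀₁ ∙ g₁₀)        ≈⟨ inverseʳ (g₀₁ ∙ g₁₀) ⟩
    ε                                ∎
    where
    g₀₀ g₀₁ g₁₀ g₁₁ : Carrier
    g₀₀ = g (corner false false)
    g₀₁ = g (corner false true)
    g₁₀ = g (corner true false)
    g₁₁ = g (corner true true)

  infix 8 _·_
  _·_ : ∀ {n} → Vertex n → Vec Carrier n → Carrier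
  []      · []       = ε
  (b ∷ w) · (h ∷ hs) = bit b × h ∙ w · hs

  ·-parallelogram : ∀ {n} (p q r s : Vertex n) (hs : Vec Carrier n) →
    (∀ i → bit (lookup p i) ℕ.+ bit (lookup s i) ≡ bit (lookup q i) ℕ.+ bit (lookup r i)) →
    p · hs ∙ s · hs ≈ q · hs ∙ r · hs
  ·-parallelogram [] [] [] [] [] _ = refl
  ·-parallelogram (p ∷ ps) (q ∷ qs) (r ∷ rs) (s ∷ ss) (h ∷ hs) bits≡ = begin
    (bit p × h ∙ ps · hs) ∙ (bit s × h ∙ ss · hs)   ≈⟨ interchange _ _ _ _ ⟩
    (bit p × h ∙ bit s × h) ∙ (ps · hs ∙ ss · hs)   ≈⟨ ∙-cong head≈ tail≈ ⟩
    (bit q × h ∙ bit r × h) ∙ (qs · hs ∙ rs · hs)   ≈⟨ interchange _ _ _ _ ⟩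
    (bit q × h ∙ qs · hs) ∙ (bit r × h ∙ rs · hs)   ∎
    where
    head≈ : bit p × h ∙ bit s × h ≈ bit q × h ∙ bit r × h
    head≈ = begin
      bit p × h ∙ bit s × h   ≈⟨ ×-homo-+ h (bit p) (bit s) ⟨
      (bit p ℕ.+ bit s) × h   ≡⟨ ≡.cong (_× h) (bits≡ Fin.zero) ⟩
      (bit q ℕ.+ bit r) × h   ≈⟨ ×-homo-+ h (bit q) (bit r) ⟩
      bit q × h ∙ bit r × h   ∎
    tail≈ : ps · hs ∙ ss · hs ≈ qs · hs ∙ rs · hs
    tail≈ = ·-parallelogram ps qs rs ss hs (λ i → bits≡ (Fin.suc i))

  parallelepiped : ∀ {n} → Carrier → Vec Carrier n → Vertex n → Carrier
  parallelepiped x hs w = x ∙ w · hs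

  parallelepiped-false : ∀ {n} x h (hs : Vec Carrier n) w →
    parallelepiped x (h ∷ hs) (false ∷ w) ≈ parallelepiped x hs w
  parallelepiped-false x h hs w = ∙-congˡ (identityˡ (w · hs))

  parallelepiped-true : ∀ {n} x h (hs : Vec Carrier n) w →
    parallelepiped x (h ∷ hs) (true ∷ w) ≈ parallelepiped (x ∙ h) hs w
  parallelepiped-true x h hs w = trans (∙-congˡ (∙-congʳ (×-homo-1 h))) (sym (assoc x h (w · hs)))

  parallelepiped-isCube₁ : ∀ n x (hs : Vec Carrier n) → IsCube Z 1 n (parallelepiped x hs)
  parallelepiped-isCube₁ n x hs ψ ψ-isCubeMorphism _ = altSum₂≈ε (parallelepiped x hs ∘ ψ) (begin
    (x ∙ P) ∙ (x ∙ S)   ≈⟨ interchange x P x S ⟩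
    (x ∙ x) ∙ (P ∙ S)   ≈⟨ ∙-congˡ (·-parallelogram p q r s hs (cubeMorphism-parallelogram ψ ψ-isCubeMorphism)) ⟩
    (x ∙ x) ∙ (Q ∙ R)   ≈⟨ interchange x x Q R ⟩
    (x ∙ Q) ∙ (x ∙ R)   ∎)
    where
    p q r s : Vertex n
    p = ψ (corner false false)
    q = ψ (corner false true)
    r = ψ (corner true false)
    s = ψ (corner true true)
    P Q R S : Carrier
    P = p · hs
    Q = q · hs
    R = r · hs
    S = s · hs

descend-to-0 : ∀ {p} (Q : ℕ → Set p) → (∀ k → Q (suc k) → Q k) → ∀ k → Q k → Q 0
descend-to-0 Q step zero    q = q
descend-to-0 Q step (suc k) q = descend-to-0 Q step k (step k q)

module Differences {c₁ ℓ₁ c₂ ℓ₂ : Level} (Z₁ : AbelianGroup c₁ ℓ₁) (Z₂ : AbelianGroup c₂ ℓ₂) where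
  private
    module Z₁ = AbelianGroup Z₁
    module P₁ = AbelianGroupProperties Z₁
  open AbelianGroup Z₂
  open AbelianGroupProperties Z₂
  open import Algebra.Properties.Group group using (x∙y⁻¹≈ε⇒x≈y; ∙-cancelʳ; //-cong₂)
  open import Algebra.Properties.Group Z₁.group using (\\-leftDividesˡ)
  open import Relation.Binary.Reasoning.Setoid setoid

  Δₕ : Z₁.Carrier → (Z₁.Carrier → Carrier) → Z₁.Carrier → Carrier
  Δₕ h f x = f x - f (x Z₁.∙ h)

  Δ : ∀ {k} → Vec Z₁.Carrier k → (Z₁.Carrier → Carrier) → Z₁.Carrier → Carrier
  Δ []       f = f
  Δ (h ∷ hs) f = Δₕ h (Δ hs f)

  IsPolynomial : ℕ → (Z₁.Carrier → Carrier) → Set (c₁ ⊔ ℓ₂)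
  IsPolynomial k f = ∀ (hs : Vec Z₁.Carrier (suc k)) x → Δ hs f x ≈ ε

  Δ-cong : ∀ {k f} (hs : Vec Z₁.Carrier k) → Congruent Z₁._≈_ _≈_ f → Congruent Z₁._≈_ _≈_ (Δ hs f)
  Δ-cong []       f-cong = f-cong
  Δ-cong (h ∷ hs) f-cong x≈y = //-cong₂ (Δ-cong hs f-cong x≈y) (Δ-cong hs f-cong (Z₁.∙-congʳ x≈y))

  altSum∘parallelepiped≈Δ : ∀ {k f} → Congruent Z₁._≈_ _≈_ f → ∀ (hs : Vec Z₁.Carrier k) x →
    altSum Z₂ k (f ∘ P₁.parallelepiped x hs) ≈ Δ hs f x
  altSum∘parallelepiped≈Δ f-cong []       x = f-cong (Z₁.identityʳ x)
  altSum∘parallelepiped≈Δ {suc k} f-cong (h ∷ hs) x = //-cong₂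
    (trans (altSum-cong k (f-cong ∘ P₁.parallelepiped-false x h hs))
           (altSum∘parallelepiped≈Δ f-cong hs x))
    (trans (altSum-cong k (f-cong ∘ P₁.parallelepiped-true x h hs))
           (altSum∘parallelepiped≈Δ f-cong hs (x Z₁.∙ h)))

  morphism⇒polynomial : ∀ {ℓ φ} → IsNilspaceMorphism Z₁ 1 Z₂ ℓ φ → IsPolynomial ℓ φ
  morphism⇒polynomial {ℓ} {φ} (φ-cong , φ-preserves-cubes) hs x = begin
    Δ hs φ x                                      ≈⟨ altSum∘parallelepiped≈Δ φ-cong hs x ⟨
    altSum Z₂ (suc ℓ) (φ ∘ P₁.parallelepiped x hs) ≈⟨ image-cube id (id-isCubeMorphism (suc ℓ)) id ⟩
    ε                                              ∎
    where
    image-cube : IsCube Z₂ ℓ (suc ℓ) (φ ∘ P₁.parallelepiped x hs)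
    image-cube = φ-preserves-cubes (suc ℓ) (P₁.parallelepiped x hs) (P₁.parallelepiped-isCube₁ (suc ℓ) x hs)

  telescope : ∀ {f h} → Congruent Z₁._≈_ _≈_ f → (∀ y h′ → Δₕ h f y ≈ Δₕ h f (y Z₁.∙ h′)) →
    ∀ m x → f x ≈ m × Δₕ h f x ∙ f (x Z₁.∙ m P₁.× h)
  telescope f-cong Δₕf-invariant zero x =
    trans (f-cong (Z₁.sym (Z₁.identityʳ x))) (sym (identityˡ _))
  telescope {f} {h} f-cong Δₕf-invariant (suc m) x = begin
    f x
      ≈⟨ telescope f-cong Δₕf-invariant m x ⟩
    m × Δₕ h f x ∙ f y
      ≈⟨ ∙-congˡ f-unfold ⟨
    m × Δₕ h f x ∙ (Δₕ h f y ∙ f (y Z₁.∙ h))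
      ≈⟨ ∙-congˡ (∙-cong (sym (Δₕf-invariant x (m P₁.× h))) (f-cong y∙h≈x∙suc-m×h)) ⟩
    m × Δₕ h f x ∙ (Δₕ h f x ∙ f (x Z₁.∙ suc m P₁.× h))
      ≈⟨ assoc _ _ _ ⟨
    (m × Δₕ h f x ∙ Δₕ h f x) ∙ f (x Z₁.∙ suc m P₁.× h)
      ≈⟨ ∙-congʳ (comm _ _) ⟩
    suc m × Δₕ h f x ∙ f (x Z₁.∙ suc m P₁.× h)
      ∎
    where
    y : Z₁.Carrier
    y = x Z₁.∙ m P₁.× h
    f-unfold : Δₕ h f y ∙ f (y Z₁.∙ h) ≈ f y
    f-unfold = trans (assoc _ _ _) (trans (∙-congˡ (inverseˡ _)) (identityʳ _))
    y∙h≈x∙suc-m×h : y Z₁.∙ h Z₁.≈ x Z₁.∙ suc m P₁.× h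
    y∙h≈x∙suc-m×h = Z₁.trans (Z₁.assoc _ _ _) (Z₁.∙-congˡ (Z₁.comm _ _))

  order-annihilates-invariant-Δₕ : ∀ {n f h} → HasOrder Z₁ n → Congruent Z₁._≈_ _≈_ f →
    (∀ y h′ → Δₕ h f y ≈ Δₕ h f (y Z₁.∙ h′)) → ∀ x → n × Δₕ h f x ≈ ε
  order-annihilates-invariant-Δₕ {n} {f} {h} Z₁-order f-cong Δₕf-invariant x = ∙-cancelʳ (f x) _ _ (begin
    n × Δₕ h f x ∙ f x                   ≈⟨ ∙-congˡ (f-cong x∙n×h≈x) ⟨
    n × Δₕ h f x ∙ f (x Z₁.∙ n P₁.× h)   ≈⟨ telescope f-cong Δₕf-invariant n x ⟨
    f x                                 ≈⟨ identityˡ (f x) ⟨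
    ε ∙ f x                             ∎)
    where
    x∙n×h≈x : x Z₁.∙ n P₁.× h Z₁.≈ x
    x∙n×h≈x = Z₁.trans (Z₁.∙-congˡ (P₁.HasOrder⇒×≈ε Z₁-order h)) (Z₁.identityʳ x)

  polynomial-degree-descends : ∀ {n₁ n₂ k f} → HasOrder Z₁ n₁ → HasOrder Z₂ n₂ → Coprime n₁ n₂ →
    Congruent Z₁._≈_ _≈_ f → IsPolynomial (suc k) f → IsPolynomial k f
  polynomial-degree-descends {f = f} Z₁-order Z₂-order n₁⊥n₂ f-cong f-poly (h ∷ hs) x =
    coprime-×≈ε⇒≈ε n₁⊥n₂
      (order-annihilates-invariant-Δₕ Z₁-order (Δ-cong hs f-cong) Δₕ-invariant x)
      (HasOrder⇒×≈ε Z₂-order _)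
    where
    Δₕ-invariant : ∀ y h′ → Δ (h ∷ hs) f y ≈ Δ (h ∷ hs) f (y Z₁.∙ h′)
    Δₕ-invariant y h′ = x∙y⁻¹≈ε⇒x≈y _ _ (f-poly (h′ ∷ h ∷ hs) y)

  polynomial₀⇒constant : ∀ {f} → Congruent Z₁._≈_ _≈_ f → IsPolynomial 0 f → ∀ x y → f x ≈ f y
  polynomial₀⇒constant f-cong f-poly x y =
    trans (x∙y⁻¹≈ε⇒x≈y _ _ (f-poly (x Z₁.⁻¹ Z₁.∙ y ∷ []) x)) (f-cong (\\-leftDividesˡ x y))

lemma6p6 : {c₁ ℓ₁ c₂ ℓ₂ : Level} (Z₁ : AbelianGroup c₁ ℓ₁) (Z₂ : AbelianGroup c₂ ℓ₂)
    (n₁ n₂ : ℕ) → HasOrder Z₁ n₁ → HasOrder Z₂ n₂ → Coprime n₁ n₂ →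
    (ℓ : ℕ) (φ : AbelianGroup.Carrier Z₁ → AbelianGroup.Carrier Z₂) →
    IsNilspaceMorphism Z₁ 1 Z₂ ℓ φ →
    (x y : AbelianGroup.Carrier Z₁) → AbelianGroup._≈_ Z₂ (φ x) (φ y)
lemma6p6 Z₁ Z₂ n₁ n₂ Z₁-order Z₂-order n₁⊥n₂ ℓ φ φ-morphism@(φ-cong , _) =
  polynomial₀⇒constant φ-cong
    (descend-to-0 (λ k → IsPolynomial k φ)
      (λ _ → polynomial-degree-descends Z₁-order Z₂-order n₁⊥n₂ φ-cong)
      ℓ (morphism⇒polynomial φ-morphism))
  where open Differences Z₁ Z₂
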